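{- Let $A$ and $B$ be two disjoint bases of a matroid $M$, and let $a',a''\in A$ be distinct. Let $$\mathrm{Conn}(a',a'',A,B)=\{b\in B : b\in C(B,a')\ \text{and}\ a''\in C(A,b)\}.$$ Then $|\mathrm{Conn}(a',a'',A,B)|\neq 1$.
   Context: For an independent set $I$ and an element $x$ such that $I+x=I\cup\{x\}$ is dependent, $C(I,x)$ denotes the unique minimal subset of $I$ that spans $x$ (equivalently, $C(I,x)\cup\{x\}$ is the unique circuit contained in $I\cup\{x\}$, and $C(I,x)$ is this circuit minus $x$). -}

module Defs where

open import Level using (0ℓ)
open import Data.Nat using (ℕ; _<_)
open import Data.Fin using (Fin)
open import Data.Fin.Subset using (Subset; _∈_; _∉_; _⊆_; _∪_; ⁅_⁆; ∣_∣; ⊥)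
open import Data.Product using (Σ; ∃; _×_)
open import Relation.Nullary using (¬_)
open import Relation.Binary.PropositionalEquality using (_≡_; _≢_)

record Matroid (n : ℕ) : Set₁ where
  field
    Indep      : Subset n → Set
    indep-∅    : Indep ⊥
    indep-⊆    : ∀ {X Y} → Y ⊆ X → Indep X → Indep Y
    augment    : ∀ {X Y} → Indep X → Indep Y → ∣ X ∣ < ∣ Y ∣ →
                 ∃ λ y → y ∈ Y × y ∉ X × Indep (X ∪ ⁅ y ⁆)

module _ {n : ℕ} (M : Matroid n) where
  open Matroid M

  Dependent : Subset n → Set
  Dependent X = ¬ Indep X

  IsBase : Subset n → Set
  IsBase B = Indep B × (∀ X → Indep X → B ⊆ X → X ⊆ B)

  IsCircuit : Subset n → Set
  IsCircuit C = Dependent C × (∀ D → D ⊆ C → ¬ (C ⊆ D) → Indep D)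

  -- y ∈ C(I , x): y lies in the (unique) circuit contained in I + x, and y ≠ x
  -- (used only when I is independent and I + x is dependent).
  InFundCirc : Subset n → Fin n → Fin n → Set
  InFundCirc I x y =
    ∃ λ C → IsCircuit C × C ⊆ (I ∪ ⁅ x ⁆) × y ∈ C × y ≢ x

  Conn : Fin n → Fin n → Subset n → Subset n → Fin n → Set
  Conn a′ a″ A B b = b ∈ B × InFundCirc B a′ b × InFundCirc A b a″

ExactlyOne : {n : ℕ} → (Fin n → Set) → Set
ExactlyOne P = ∃ λ b → P b × (∀ b′ → P b′ → b′ ≡ b)

-- Let b be the unique connector, with fundamental circuits D₁ = C(B,a′) + a′ ∋ b and
-- D₂ = C(A,b) + b ∋ a″, and put I = A - a″.  Every e ∈ D₁ - b is spanned by I: either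
-- e = a′ ∈ I, or e ∈ B with e ∉ Conn, so a″ ∉ C(A,e) and I + e is dependent.  A rank
-- count now gives a contradiction: D₂ - a″ extends inside A to an independent L ⊆ I + b
-- of size ∣ A ∣, and D₁ - b extends inside L to an independent K of size at least ∣ A ∣
-- avoiding b; then K is spanned by I although ∣ I ∣ < ∣ A ∣ ≤ ∣ K ∣.
module Submission where

open import Defs
open import Data.Nat using (ℕ; zero; suc; _+_; _≤_; _<_; s≤s)
open import Data.Nat.Properties
  using (≤-refl; <-≤-trans; <-irrefl; ≮⇒≥; ≰⇒>; m≤m+n; +-suc; +-monoʳ-≤; _≤?_; module ≤-Reasoning)
open import Data.Fin using (Fin; _≟_)
open import Data.Fin.Subset using (Subset; _∈_; _∉_; _⊆_; _⊂_; _∪_; ⁅_⁆; ∣_∣; _─_; _-_; inside; outside)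
open import Data.Fin.Subset.Properties
open import Data.Vec.Base using ([]; _∷_; here; there)
open import Data.Product using (∃; _×_; _,_)
open import Data.Sum using (inj₁; inj₂; _⊎_; [_,_])
open import Relation.Nullary using (¬_; yes; no; ¬?; contradiction)
open import Relation.Nullary.Decidable using (_×-dec_; decidable-stable; ¬¬-excluded-middle)
open import Relation.Unary using (Decidable)
open import Relation.Binary.PropositionalEquality using (_≢_; refl; sym; subst)

x∈p─q⇒x∉q : ∀ {n} {x : Fin n} (p q : Subset n) → x ∈ p ─ q → x ∉ q
x∈p─q⇒x∉q (inside ∷ p) (outside ∷ q) here       = λ ()
x∈p─q⇒x∉q (_ ∷ p)      (_ ∷ q)       (there x∈) (there x∈q) = x∈p─q⇒x∉q p q x∈ x∈q

module _ {n : ℕ} where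

  x∈p-y⇒x≢y : ∀ {x y : Fin n} (p : Subset n) → x ∈ p - y → x ≢ y
  x∈p-y⇒x≢y {y = y} p x∈p-y refl = x∈p─q⇒x∉q p ⁅ y ⁆ x∈p-y (x∈⁅x⁆ y)

  x∈p∪⁅y⁆∧x≢y⇒x∈p : ∀ {x y : Fin n} {p : Subset n} → x ∈ p ∪ ⁅ y ⁆ → x ≢ y → x ∈ p
  x∈p∪⁅y⁆∧x≢y⇒x∈p {y = y} {p} x∈ x≢y =
    [ (λ x∈p → x∈p) , (λ x∈⁅y⁆ → contradiction (x∈⁅y⁆⇒x≡y y x∈⁅y⁆) x≢y) ] (x∈p∪q⁻ p ⁅ y ⁆ x∈)

  ∪-lub : ∀ {p q r : Subset n} → p ⊆ r → q ⊆ r → p ∪ q ⊆ r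
  ∪-lub {p} {q} p⊆r q⊆r x∈ = [ p⊆r , q⊆r ] (x∈p∪q⁻ p q x∈)

  ⊆∧⊉⇒⊂ : ∀ {p q : Subset n} → p ⊆ q → ¬ (q ⊆ p) → p ⊂ q
  ⊆∧⊉⇒⊂ {p} {q} p⊆q q⊈p with p ⊂? q
  ... | yes p⊂q = p⊂q
  ... | no  p⊄q = contradiction
    (λ {x} x∈q → decidable-stable (x ∈? p) (λ x∉p → p⊄q (p⊆q , x , x∈q , x∉p))) q⊈p

¬¬-decidable : ∀ {n} (P : Subset n → Set) → ¬ ¬ Decidable P
¬¬-decidable {zero}  P k = ¬¬-excluded-middle (λ P[]? → k λ { [] → P[]? })
¬¬-decidable {suc n} P k =
  ¬¬-decidable (λ X → P (inside ∷ X)) λ P-in? →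
  ¬¬-decidable (λ X → P (outside ∷ X)) λ P-out? →
  k λ { (inside ∷ X) → P-in? X ; (outside ∷ X) → P-out? X }

module _ {n : ℕ} (M : Matroid n) where
  open Matroid M

  -- x lies in the closure of I (meaningful when I is independent).
  Spans : Subset n → Fin n → Set
  Spans I x = x ∈ I ⊎ Dependent M (I ∪ ⁅ x ⁆)

  spanned⇒∣K∣≤∣I∣ : ∀ {I K} → Indep I → Indep K → (∀ {x} → x ∈ K → Spans I x) → ∣ K ∣ ≤ ∣ I ∣
  spanned⇒∣K∣≤∣I∣ iI iK spanned = ≮⇒≥ λ ∣I∣<∣K∣ →
    let y , y∈K , y∉I , iI+y = augment iI iK ∣I∣<∣K∣
    in  [ y∉I , (λ dI+y → dI+y iI+y) ] (spanned y∈K)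

  circuit-minus-indep : ∀ {C x} → IsCircuit M C → x ∈ C → Indep (C - x)
  circuit-minus-indep {C} {x} (_ , minimal) x∈C =
    minimal (C - x) (p─q⊆p C ⁅ x ⁆) (λ C⊆C-x → x∈p-y⇒x≢y C (C⊆C-x x∈C) refl)

  circuit-minus⊆indep⇒∉ : ∀ {C x X} → IsCircuit M C → C - x ⊆ X → Indep X → x ∉ X
  circuit-minus⊆indep⇒∉ {C} {x} {X} (dC , _) C-x⊆X iX x∈X = dC (indep-⊆ C⊆X iX)
    where
    C⊆X : C ⊆ X
    C⊆X {y} y∈C with y ≟ x
    ... | yes refl = x∈X
    ... | no  y≢x  = C-x⊆X (x∈p∧x≢y⇒x∈p-y y∈C y≢x)

  extend-within : ∀ {K L} → Indep K → Indep L →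
    ∃ λ K′ → Indep K′ × K ⊆ K′ × K′ ⊆ K ∪ L × ∣ L ∣ ≤ ∣ K′ ∣
  extend-within {K} {L} iK iL = go ∣ L ∣ (m≤m+n ∣ L ∣ ∣ K ∣) iK
    where
    go : ∀ k {K} → ∣ L ∣ ≤ k + ∣ K ∣ → Indep K →
      ∃ λ K′ → Indep K′ × K ⊆ K′ × K′ ⊆ K ∪ L × ∣ L ∣ ≤ ∣ K′ ∣
    go zero {K} L≤K iK = K , iK , ⊆-refl , p⊆p∪q L , L≤K
    go (suc k) {K} L≤k+1+K iK with ∣ L ∣ ≤? ∣ K ∣
    ... | yes L≤K = K , iK , ⊆-refl , p⊆p∪q L , L≤K
    ... | no  L≰K with augment iK iL (≰⇒> L≰K)
    ...   | y , y∈L , y∉K , iK+y with go k L≤k+K+y iK+y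
      where
      open ≤-Reasoning
      K⊂K+y : K ⊂ K ∪ ⁅ y ⁆
      K⊂K+y = p⊆p∪q ⁅ y ⁆ , y , q⊆p∪q K ⁅ y ⁆ (x∈⁅x⁆ y) , y∉K
      L≤k+K+y : ∣ L ∣ ≤ k + ∣ K ∪ ⁅ y ⁆ ∣
      L≤k+K+y = begin
        ∣ L ∣                  ≤⟨ L≤k+1+K ⟩
        suc k + ∣ K ∣          ≡⟨ +-suc k ∣ K ∣ ⟨
        k + suc ∣ K ∣          ≤⟨ +-monoʳ-≤ k (p⊂q⇒∣p∣<∣q∣ K⊂K+y) ⟩
        k + ∣ K ∪ ⁅ y ⁆ ∣      ∎
    ...     | K′ , iK′ , K+y⊆K′ , K′⊆K+y∪L , L≤K′ =
      K′ , iK′ , ⊆-trans (p⊆p∪q ⁅ y ⁆) K+y⊆K′ , ⊆-trans K′⊆K+y∪L K+y∪L⊆K∪L , L≤K′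
      where
      K+y∪L⊆K∪L : (K ∪ ⁅ y ⁆) ∪ L ⊆ K ∪ L
      K+y∪L⊆K∪L = ∪-lub (∪-lub (p⊆p∪q L) (λ {x} x∈⁅y⁆ →
        q⊆p∪q K L (subst (_∈ L) (sym (x∈⁅y⁆⇒x≡y y x∈⁅y⁆)) y∈L))) (q⊆p∪q K L)

  extend-circuit-minus : ∀ {C x L} → IsCircuit M C → x ∈ C → Indep L →
    ∃ λ K → Indep K × K ⊆ (C - x) ∪ L × x ∉ K × ∣ L ∣ ≤ ∣ K ∣
  extend-circuit-minus cC x∈C iL with extend-within (circuit-minus-indep cC x∈C) iL
  ... | K , iK , C-x⊆K , K⊆ , L≤K = K , iK , K⊆ , circuit-minus⊆indep⇒∉ cC C-x⊆K iK , L≤K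

  module _ (Indep? : Decidable Indep) where

    circuit-in-dependent : ∀ {X} → Dependent M X → ∃ λ C → IsCircuit M C × C ⊆ X
    circuit-in-dependent {X} = go (suc ∣ X ∣) X ≤-refl
      where
      go : ∀ k X → ∣ X ∣ < k → Dependent M X → ∃ λ C → IsCircuit M C × C ⊆ X
      go (suc k) X (s≤s ∣X∣≤k) dX
        with anySubset? (λ D → (D ⊂? X) ×-dec ¬? (Indep? D))
      ... | yes (D , D⊂X , dD) with go k D (<-≤-trans (p⊂q⇒∣p∣<∣q∣ D⊂X) ∣X∣≤k) dD
      ...   | C , cC , C⊆D = C , cC , ⊆-trans C⊆D (p⊂q⇒p⊆q D⊂X)
      go (suc k) X _ dX | no no-smaller = X , (dX , minimal) , ⊆-refl
        where
        minimal : ∀ D → D ⊆ X → ¬ (X ⊆ D) → Indep D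
        minimal D D⊆X X⊈D =
          decidable-stable (Indep? D) (λ dD → no-smaller (D , ⊆∧⊉⇒⊂ D⊆X X⊈D , dD))

    exchangeable⇒∈fundamental-circuit : ∀ {A e a} → IsBase M A → e ∉ A → a ∈ A →
      Indep ((A - a) ∪ ⁅ e ⁆) → InFundCirc M A e a
    exchangeable⇒∈fundamental-circuit {A} {e} {a} (iA , maximal) e∉A a∈A iA-a+e
      with circuit-in-dependent dA+e
      where
      dA+e : Dependent M (A ∪ ⁅ e ⁆)
      dA+e iA+e = e∉A (maximal _ iA+e (p⊆p∪q ⁅ e ⁆) (q⊆p∪q A ⁅ e ⁆ (x∈⁅x⁆ e)))
    ... | C , cC@(dC , _) , C⊆A+e = C , cC , C⊆A+e , a∈C , (λ { refl → e∉A a∈A })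
      where
      a∈C : a ∈ C
      a∈C = decidable-stable (a ∈? C) λ a∉C → dC (indep-⊆ (C⊆A-a+e a∉C) iA-a+e)
        where
        C⊆A-a+e : a ∉ C → C ⊆ (A - a) ∪ ⁅ e ⁆
        C⊆A-a+e a∉C {x} x∈C = [ (λ x∈A → p⊆p∪q ⁅ e ⁆ (x∈p∧x≢y⇒x∈p-y x∈A λ { refl → a∉C x∈C }))
                              , q⊆p∪q (A - a) ⁅ e ⁆ ] (x∈p∪q⁻ A ⁅ e ⁆ (C⊆A+e x∈C))

    no-unique-connector : ∀ {A B a′ a″} → IsBase M A → (∀ x → x ∈ A → x ∉ B) →
      a′ ∈ A → a″ ∈ A → a′ ≢ a″ → ¬ ExactlyOne (Conn M a′ a″ A B)
    no-unique-connector {A} {B} {a′} {a″} bA@(iA , _) disjoint a′∈A a″∈A a′≢a″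
      (b , (_ , (D₁ , cD₁ , D₁⊆B+a′ , b∈D₁ , _) , (D₂ , cD₂ , D₂⊆A+b , a″∈D₂ , _)) , unique)
      with extend-circuit-minus cD₂ a″∈D₂ iA
    ... | L , iL , L⊆D₂-a″∪A , a″∉L , ∣A∣≤∣L∣
      with extend-circuit-minus cD₁ b∈D₁ iL
    ... | K , iK , K⊆D₁-b∪L , b∉K , ∣L∣≤∣K∣ = <-irrefl refl (begin-strict
      ∣ I ∣  <⟨ x∈p⇒∣p-x∣<∣p∣ a″∈A ⟩
      ∣ A ∣  ≤⟨ ∣A∣≤∣L∣ ⟩
      ∣ L ∣  ≤⟨ ∣L∣≤∣K∣ ⟩
      ∣ K ∣  ≤⟨ spanned⇒∣K∣≤∣I∣ iI iK I-spans-K ⟩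
      ∣ I ∣  ∎)
      where
      open ≤-Reasoning
      I : Subset n
      I = A - a″
      iI : Indep I
      iI = indep-⊆ (p─q⊆p A ⁅ a″ ⁆) iA

      L-b⊆I : ∀ {x} → x ∈ L → x ≢ b → x ∈ I
      L-b⊆I {x} x∈L x≢b = x∈p∧x≢y⇒x∈p-y x∈A (λ { refl → a″∉L x∈L })
        where
        x∈A : x ∈ A
        x∈A = [ (λ x∈D₂-a″ → x∈p∪⁅y⁆∧x≢y⇒x∈p (D₂⊆A+b (p─q⊆p D₂ ⁅ a″ ⁆ x∈D₂-a″)) x≢b)
              , (λ x∈A → x∈A) ] (x∈p∪q⁻ (D₂ - a″) A (L⊆D₂-a″∪A x∈L))

      I-spans-D₁-b : ∀ {x} → x ∈ D₁ - b → Spans I x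
      I-spans-D₁-b {x} x∈D₁-b with x ≟ a′
      ... | yes refl = inj₁ (x∈p∧x≢y⇒x∈p-y a′∈A a′≢a″)
      ... | no  x≢a′ = inj₂ λ iI+x → x∈p-y⇒x≢y D₁ x∈D₁-b (unique x
              (x∈B , (D₁ , cD₁ , D₁⊆B+a′ , x∈D₁ , x≢a′)
                   , exchangeable⇒∈fundamental-circuit bA (λ x∈A → disjoint x x∈A x∈B) a″∈A iI+x))
        where
        x∈D₁ : x ∈ D₁
        x∈D₁ = p─q⊆p D₁ ⁅ b ⁆ x∈D₁-b
        x∈B : x ∈ B
        x∈B = x∈p∪⁅y⁆∧x≢y⇒x∈p (D₁⊆B+a′ x∈D₁) x≢a′

      I-spans-K : ∀ {x} → x ∈ K → Spans I x
      I-spans-K {x} x∈K = [ I-spans-D₁-b , (λ x∈L → inj₁ (L-b⊆I x∈L λ { refl → b∉K x∈K })) ]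
        (x∈p∪q⁻ (D₁ - b) L (K⊆D₁-b∪L x∈K))

proposition2p8 : {n : ℕ} (M : Matroid n) (A B : Subset n) →
    IsBase M A → IsBase M B → (∀ x → x ∈ A → x ∉ B) →
    (a′ a″ : Fin n) → a′ ∈ A → a″ ∈ A → a′ ≢ a″ →
    ¬ ExactlyOne (Conn M a′ a″ A B)
-- The goal is a negation, so independence may be assumed decidable.
proposition2p8 M A B bA _ disjoint a′ a″ a′∈A a″∈A a′≢a″ one =
  ¬¬-decidable (Matroid.Indep M) λ Indep? →
    no-unique-connector M Indep? bA disjoint a′∈A a″∈A a′≢a″ one
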